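{- Let $\Gamma$ be a basis, $M$ a $CL$-term and $\sigma$ a simple type. If $\Gamma\vdash_{CL^=}M:\sigma$, then $\Gamma\models M:\sigma$.
   Context: $CL$-terms: $M,N ::= x \mid \mathsf{S} \mid \mathsf{K} \mid \mathsf{I} \mid MN$ over a countable set $V$ of term variables. The equational theory $\mathcal{EQ}^\eta$ has axioms $M=M$, $\mathsf S MNL=(ML)(NL)$, $\mathsf K MN=M$, $\mathsf I M=M$ and rules: symmetry, transitivity, from $M=N$ infer $MP=NP$ and $PM=PN$, and from $Mx=Nx$ with $x$ not occurring in $M$ or $N$ infer $M=N$. Simple types $\sigma ::= a\mid\sigma\to\tau$ (set ${\sf Types}$). A basis is a set of declarations $x:\sigma$ with pairwise distinct variables. The system $CL_\rightarrow^=$ derives $\Gamma\vdash_{CL^=}M:\sigma$ by: $x:\sigma$ if $x:\sigma\in\Gamma$; $\mathsf S:(\sigma\to(\rho\to\tau))\to((\sigma\to\rho)\to(\sigma\to\tau))$; $\mathsf K:\sigma\to(\tau\to\sigma)$; $\mathsf I:\sigma\to\sigma$ (all types); from $M:\sigma\to\tau$ and $N:\sigma$ infer $MN:\tau$; and (eq): from $\Gamma\vdash_{CL^=}M:\sigma$ and $M=N$ provable in $\mathcal{EQ}^\eta$ infer $\Gamma\vdash_{CL^=}N:\sigma$. An applicative structure for $LCL$ is $\langle D,\{A^\sigma\}_{\sigma\in{\sf Types}},\cdot,\mathbf s,\mathbf k,\mathbf i\rangle$ with $D$ nonempty, $A^\sigma\subseteq D$, $\cdot:D\times D\to D$ extensional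 (if $d_1\cdot e=d_2\cdot e$ for all $e$ then $d_1=d_2$) and mapping $A^{\sigma\to\tau}\times A^\sigma$ into $A^\tau$; $\mathbf s\in A^{(\sigma\to(\tau\to\rho))\to((\sigma\to\tau)\to(\sigma\to\rho))}$ for all $\sigma,\tau,\rho$ with $((\mathbf s\cdot d)\cdot e)\cdot f=(d\cdot f)\cdot(e\cdot f)$; $\mathbf k\in A^{\sigma\to(\tau\to\sigma)}$ for all $\sigma,\tau$ with $(\mathbf k\cdot d)\cdot e=d$; $\mathbf i\in A^{\sigma\to\sigma}$ for all $\sigma$ with $\mathbf i\cdot d=d$. An $LCL$-model $\mathcal M_\rho$ is such a structure with an environment $\rho:V\to D$. Interpretation: $[\![x]\!]_\rho=\rho(x)$, $[\![\mathsf S]\!]_\rho=\mathbf s$, $[\![\mathsf K]\!]_\rho=\mathbf k$, $[\![\mathsf I]\!]_\rho=\mathbf i$, $[\![MN]\!]_\rho=[\![M]\!]_\rho\cdot[\![N]\!]_\rho$. $\mathcal M_\rho\models M:\sigma$ iff $[\![M]\!]_\rho\in A^\sigma$. $\Gamma\models M:\sigma$ means every $LCL$-model satisfying all declarations in $\Gamma$ satisfies $M:\sigma$. -}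

module Defs where

open import Level using (Level; suc; _⊔_)
open import Data.Nat using (ℕ)
open import Data.Product using (_×_; _,_; proj₁)
open import Data.List using (List; map)
open import Data.List.Membership.Propositional using (_∈_)
open import Data.List.Relation.Unary.Unique.Propositional using (Unique)
open import Relation.Binary.PropositionalEquality using (_≡_)
open import Relation.Nullary using (¬_)

Var : Set
Var = ℕ

infixl 9 _·_
data Term : Set where
  var : Var → Term
  S K I : Term
  _·_ : Term → Term → Term

data Occurs (x : Var) : Term → Set where
  here : Occurs x (var x)
  left : ∀ {M N} → Occurs x M → Occurs x (M · N)
  right : ∀ {M N} → Occurs x N → Occurs x (M · N)

infix 4 _≐_
data _≐_ : Term → Term → Set where
  refl≐ : ∀ {M} → M ≐ M
  axS : ∀ {M N L} → S · M · N · L ≐ (M · L) · (N · L)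
  axK : ∀ {M N} → K · M · N ≐ M
  axI : ∀ {M} → I · M ≐ M
  sym≐ : ∀ {M N} → M ≐ N → N ≐ M
  trans≐ : ∀ {M N L} → M ≐ N → N ≐ L → M ≐ L
  appL : ∀ {M N} P → M ≐ N → M · P ≐ N · P
  appR : ∀ {M N} P → M ≐ N → P · M ≐ P · N
  ext : ∀ {M N} x → ¬ Occurs x M → ¬ Occurs x N →
        M · var x ≐ N · var x → M ≐ N

infixr 5 _⇒_
data Type : Set where
  atom : ℕ → Type
  _⇒_ : Type → Type → Type

record Basis : Set where
  field
    decls : List (Var × Type)
    distinct : Unique (map proj₁ decls)
open Basis public

infix 3 _⊢_∶_
data _⊢_∶_ (Γ : Basis) : Term → Type → Set where
  ax : ∀ {x σ} → (x , σ) ∈ decls Γ → Γ ⊢ var x ∶ σ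
  tS : ∀ {σ ρ τ} → Γ ⊢ S ∶ (σ ⇒ (ρ ⇒ τ)) ⇒ ((σ ⇒ ρ) ⇒ (σ ⇒ τ))
  tK : ∀ {σ τ} → Γ ⊢ K ∶ σ ⇒ (τ ⇒ σ)
  tI : ∀ {σ} → Γ ⊢ I ∶ σ ⇒ σ
  tapp : ∀ {M N σ τ} → Γ ⊢ M ∶ σ ⇒ τ → Γ ⊢ N ∶ σ → Γ ⊢ M · N ∶ τ
  teq : ∀ {M N σ} → Γ ⊢ M ∶ σ → M ≐ N → Γ ⊢ N ∶ σ

-- Applicative structures for LCL (subsets A^σ ⊆ D as predicates)
record ApplicativeStructure (ℓ ℓ' : Level) : Set (suc (ℓ ⊔ ℓ')) where
  infixl 9 _∙_
  field
    D : Set ℓ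
    inhabited : D
    A : Type → D → Set ℓ'
    _∙_ : D → D → D
    extensional : ∀ d₁ d₂ → (∀ e → d₁ ∙ e ≡ d₂ ∙ e) → d₁ ≡ d₂
    app-closed : ∀ {σ τ d e} → A (σ ⇒ τ) d → A σ e → A τ (d ∙ e)
    s k i : D
    s-type : ∀ σ τ ρ → A ((σ ⇒ (τ ⇒ ρ)) ⇒ ((σ ⇒ τ) ⇒ (σ ⇒ ρ))) s
    s-eq : ∀ d e f → s ∙ d ∙ e ∙ f ≡ (d ∙ f) ∙ (e ∙ f)
    k-type : ∀ σ τ → A (σ ⇒ (τ ⇒ σ)) k
    k-eq : ∀ d e → k ∙ d ∙ e ≡ d
    i-type : ∀ σ → A (σ ⇒ σ) i
    i-eq : ∀ d → i ∙ d ≡ d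

module _ {ℓ ℓ'} (𝒜 : ApplicativeStructure ℓ ℓ') where
  open ApplicativeStructure 𝒜

  ⟦_⟧ : Term → (Var → D) → D
  ⟦ var x ⟧ ρ = ρ x
  ⟦ S ⟧ ρ = s
  ⟦ K ⟧ ρ = k
  ⟦ I ⟧ ρ = i
  ⟦ M · N ⟧ ρ = ⟦ M ⟧ ρ ∙ ⟦ N ⟧ ρ

  Sat : (Var → D) → Term → Type → Set ℓ'
  Sat ρ M σ = A σ (⟦ M ⟧ ρ)

infix 3 _⊨_∶_
_⊨_∶_ : ∀ {ℓ ℓ'} → Basis → Term → Type → Set (suc (ℓ ⊔ ℓ'))
_⊨_∶_ {ℓ} {ℓ'} Γ M σ =
  (𝒜 : ApplicativeStructure ℓ ℓ') (ρ : Var → ApplicativeStructure.D 𝒜) →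
  (∀ {x τ} → (x , τ) ∈ decls Γ → Sat 𝒜 ρ (var x) τ) → Sat 𝒜 ρ M σ

-- The equations of EQ^η hold in every applicative structure: the axioms are the equations
-- of s, k and i, the congruence rules are congruence of _∙_, and the rule (ext) is sound
-- because ∙ is extensional — a variable not occurring in M or N can be sent to any element
-- without changing the values of M and N. Soundness of the type system then follows by
-- induction on derivations, the rule (eq) being sound since equal terms have equal values.
module Submission where

open import Defs
open import Level using (Level)
open import Data.Nat using (_≟_)
open import Data.Product using (_,_)
open import Data.List.Membership.Propositional using (_∈_)
open import Data.Empty using (⊥-elim)
open import Relation.Nullary using (yes; no; ¬_)
open import Relation.Binary.PropositionalEquality
  using (_≡_; refl; sym; trans; cong; cong₂; subst; module ≡-Reasoning)

module Soundness {ℓ ℓ'} (𝒜 : ApplicativeStructure ℓ ℓ') where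
  open ApplicativeStructure 𝒜

  Env : Set ℓ
  Env = Var → D

  _[_≔_] : Env → Var → D → Env
  (ρ [ x ≔ e ]) y with y ≟ x
  ... | yes _ = e
  ... | no _ = ρ y

  update-≡ : ∀ ρ x e → (ρ [ x ≔ e ]) x ≡ e
  update-≡ ρ x e with x ≟ x
  ... | yes _ = refl
  ... | no x≢x = ⊥-elim (x≢x refl)

  ⟦⟧-update-fresh : ∀ ρ x e M → ¬ Occurs x M → ⟦ 𝒜 ⟧ M (ρ [ x ≔ e ]) ≡ ⟦ 𝒜 ⟧ M ρ
  ⟦⟧-update-fresh ρ x e (var y) x∉y with y ≟ x
  ... | yes refl = ⊥-elim (x∉y here)
  ... | no _ = refl
  ⟦⟧-update-fresh ρ x e S _ = refl
  ⟦⟧-update-fresh ρ x e K _ = refl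
  ⟦⟧-update-fresh ρ x e I _ = refl
  ⟦⟧-update-fresh ρ x e (M · N) x∉MN =
    cong₂ _∙_ (⟦⟧-update-fresh ρ x e M (λ o → x∉MN (left o)))
              (⟦⟧-update-fresh ρ x e N (λ o → x∉MN (right o)))

  ⟦⟧-respects-≐ : ∀ {M N} → M ≐ N → ∀ ρ → ⟦ 𝒜 ⟧ M ρ ≡ ⟦ 𝒜 ⟧ N ρ
  ⟦⟧-respects-≐ refl≐ ρ = refl
  ⟦⟧-respects-≐ axS ρ = s-eq _ _ _
  ⟦⟧-respects-≐ axK ρ = k-eq _ _
  ⟦⟧-respects-≐ axI ρ = i-eq _
  ⟦⟧-respects-≐ (sym≐ p) ρ = sym (⟦⟧-respects-≐ p ρ)
  ⟦⟧-respects-≐ (trans≐ p q) ρ = trans (⟦⟧-respects-≐ p ρ) (⟦⟧-respects-≐ q ρ)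
  ⟦⟧-respects-≐ (appL P p) ρ = cong (_∙ ⟦ 𝒜 ⟧ P ρ) (⟦⟧-respects-≐ p ρ)
  ⟦⟧-respects-≐ (appR P p) ρ = cong (⟦ 𝒜 ⟧ P ρ ∙_) (⟦⟧-respects-≐ p ρ)
  ⟦⟧-respects-≐ (ext {M} {N} x x∉M x∉N p) ρ = extensional _ _ agree
    where
    open ≡-Reasoning
    agree : ∀ e → ⟦ 𝒜 ⟧ M ρ ∙ e ≡ ⟦ 𝒜 ⟧ N ρ ∙ e
    agree e = begin
      ⟦ 𝒜 ⟧ M ρ ∙ e                    ≡⟨ cong₂ _∙_ (sym (⟦⟧-update-fresh ρ x e M x∉M)) (sym (update-≡ ρ x e)) ⟩
      ⟦ 𝒜 ⟧ (M · var x) (ρ [ x ≔ e ])  ≡⟨ ⟦⟧-respects-≐ p (ρ [ x ≔ e ]) ⟩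
      ⟦ 𝒜 ⟧ (N · var x) (ρ [ x ≔ e ])  ≡⟨ cong₂ _∙_ (⟦⟧-update-fresh ρ x e N x∉N) (update-≡ ρ x e) ⟩
      ⟦ 𝒜 ⟧ N ρ ∙ e                    ∎

  ⊢-sound : ∀ {Γ M σ} → Γ ⊢ M ∶ σ → ∀ ρ →
            (∀ {x τ} → (x , τ) ∈ decls Γ → Sat 𝒜 ρ (var x) τ) → Sat 𝒜 ρ M σ
  ⊢-sound (ax x∶σ∈Γ) ρ ρ⊨Γ = ρ⊨Γ x∶σ∈Γ
  ⊢-sound tS ρ ρ⊨Γ = s-type _ _ _
  ⊢-sound tK ρ ρ⊨Γ = k-type _ _
  ⊢-sound tI ρ ρ⊨Γ = i-type _
  ⊢-sound (tapp ⊢M ⊢N) ρ ρ⊨Γ = app-closed (⊢-sound ⊢M ρ ρ⊨Γ) (⊢-sound ⊢N ρ ρ⊨Γ)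
  ⊢-sound {σ = σ} (teq ⊢M M≐N) ρ ρ⊨Γ =
    subst (A σ) (⟦⟧-respects-≐ M≐N ρ) (⊢-sound ⊢M ρ ρ⊨Γ)

mainTheorem15 : ∀ {ℓ ℓ' : Level} (Γ : Basis) (M : Term) (σ : Type) →
    Γ ⊢ M ∶ σ → _⊨_∶_ {ℓ} {ℓ'} Γ M σ
mainTheorem15 Γ M σ ⊢M 𝒜 = Soundness.⊢-sound 𝒜 ⊢M
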